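{- Let $\mathsf e\in\{\mathsf l,\mathsf w\}$ and $i\in\{1,3\}$. Then (1) $\to_{\neg\mathsf e\beta_v}\cdot\mapsto_{\sigma_i}\subseteq\mapsto_{\sigma_i}\cdot\to_{\beta_v}$; (2) $\to_{\neg\mathsf e\sigma}\cdot\mapsto_{\sigma_i}\subseteq\mapsto_{\sigma_i}\cdot\to_\sigma$.
   Context: Terms: $t::=x\mid c\mid\lambda x.t\mid tt$ modulo $\alpha$-equivalence ($c$ constants), $\mathrm{fv}$ free variables. Values $v::=x\mid c\mid\lambda x.t$. Contexts $C::=\langle\cdot\rangle\mid tC\mid Ct\mid\lambda x.C$; contextual closure of $\mapsto_\rho$: $C\langle r\rangle\to_\rho C\langle r'\rangle$ for $r\mapsto_\rho r'$. Rules: $(\lambda x.t)v\mapsto_{\beta_v}t\{x:=v\}$ ($v$ value); $(\lambda x.t)us\mapsto_{\sigma_1}(\lambda x.ts)u$ if $x\notin\mathrm{fv}(s)$; $v((\lambda x.t)u)\mapsto_{\sigma_3}(\lambda x.vt)u$ if $v$ is a value with $x\notin\mathrm{fv}(v)$; $\mapsto_\sigma:=\mapsto_{\sigma_1}\cup\mapsto_{\sigma_3}$, $\to_\sigma$ its contextual closure. Left contexts $L::=\langle\cdot\rangle\mid Lt\mid vL$; weak contexts $W::=\langle\cdot\rangle\mid Wt\mid tW$. $\to_{\neg\mathsf l\rho}$ / $\to_{\neg\mathsf w\rho}$ is the closure of $\mapsto_\rho$ under contexts that are not left / not weak. $R\cdot S$ is composition. -}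

module Defs where

open import Data.Nat using (ℕ; zero; suc)
open import Data.Product using (Σ; ∃; ∃-syntax; _×_; _,_)
open import Data.Empty using (⊥)
open import Data.Unit using (⊤)
open import Relation.Nullary using (¬_)
open import Relation.Binary.PropositionalEquality using (_≡_)

-- Terms modulo α-equivalence, represented with de Bruijn indices.
-- Constants are indexed by ℕ.
data Term : Set where
  var : ℕ → Term
  con : ℕ → Term
  lam : Term → Term
  app : Term → Term → Term

data Value : Term → Set where
  vvar : ∀ n → Value (var n)
  vcon : ∀ c → Value (con c)
  vlam : ∀ t → Value (lam t)

ext : (ℕ → ℕ) → ℕ → ℕ
ext ρ zero = zero
ext ρ (suc n) = suc (ρ n)

rename : (ℕ → ℕ) → Term → Term
rename ρ (var n) = var (ρ n)
rename ρ (con c) = con c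
rename ρ (lam t) = lam (rename (ext ρ) t)
rename ρ (app t u) = app (rename ρ t) (rename ρ u)

-- weakening: the term is placed under one more binder (the bound
-- variable does not occur free in it)
shift : Term → Term
shift = rename suc

exts : (ℕ → Term) → ℕ → Term
exts σ zero = var zero
exts σ (suc n) = shift (σ n)

subst : (ℕ → Term) → Term → Term
subst σ (var n) = σ n
subst σ (con c) = con c
subst σ (lam t) = lam (subst (exts σ) t)
subst σ (app t u) = app (subst σ t) (subst σ u)

single : Term → ℕ → Term
single v zero = v
single v (suc n) = var n

_[_] : Term → Term → Term
t [ v ] = subst (single v) t

Rel : Set₁
Rel = Term → Term → Set

data _↦βv_ : Rel where
  βv : ∀ t v → Value v → app (lam t) v ↦βv (t [ v ])

-- (λx.t)u s ↦ (λx.ts)u ; x ∉ fv(s) is realised by weakening s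
data _↦σ₁_ : Rel where
  σ₁ : ∀ t u s → app (app (lam t) u) s ↦σ₁ app (lam (app t (shift s))) u

-- v((λx.t)u) ↦ (λx.vt)u ; x ∉ fv(v) realised by weakening v
data _↦σ₃_ : Rel where
  σ₃ : ∀ v t u → Value v → app v (app (lam t) u) ↦σ₃ app (lam (app (shift v) t)) u

data _↦σ_ : Rel where
  s1 : ∀ {t u} → t ↦σ₁ u → t ↦σ u
  s3 : ∀ {t u} → t ↦σ₃ u → t ↦σ u

data Ctx : Set where
  hole : Ctx
  appR : Term → Ctx → Ctx
  appL : Ctx → Term → Ctx
  lamC : Ctx → Ctx

plug : Ctx → Term → Term
plug hole r = r
plug (appR t C) r = app t (plug C r)
plug (appL C t) r = app (plug C r) t
plug (lamC C) r = lam (plug C r)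

data IsLeft : Ctx → Set where
  lhole : IsLeft hole
  lappL : ∀ {C} t → IsLeft C → IsLeft (appL C t)
  lappR : ∀ {C} v → Value v → IsLeft C → IsLeft (appR v C)

data IsWeak : Ctx → Set where
  whole : IsWeak hole
  wappL : ∀ {C} t → IsWeak C → IsWeak (appL C t)
  wappR : ∀ {C} t → IsWeak C → IsWeak (appR t C)

Closure : Rel → Rel
Closure R t t' = ∃[ C ] ∃[ r ] ∃[ r' ] (R r r' × t ≡ plug C r × t' ≡ plug C r')

ClosureUnder : (Ctx → Set) → Rel → Rel
ClosureUnder P R t t' =
  ∃[ C ] ∃[ r ] ∃[ r' ] (P C × R r r' × t ≡ plug C r × t' ≡ plug C r')

_→βv_ : Rel
_→βv_ = Closure _↦βv_

_→σ_ : Rel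
_→σ_ = Closure _↦σ_

data Strat : Set where
  l w : Strat

StratCtx : Strat → Ctx → Set
StratCtx l = IsLeft
StratCtx w = IsWeak

NotE : Strat → Rel → Rel
NotE e = ClosureUnder (λ C → ¬ StratCtx e C)

data SIdx : Set where
  one three : SIdx

RootSigma : SIdx → Rel
RootSigma one = _↦σ₁_
RootSigma three = _↦σ₃_

_·_ : Rel → Rel → Rel
(R · S) t t' = ∃[ u ] (R t u × S u t')

_⊆_ : Rel → Rel → Set
R ⊆ S = ∀ {t t'} → R t t' → S t t'

module Submission where

-- Both statements are instances of one commutation lemma,
-- proved for an arbitrary root relation R that is stable under renaming:
--   →_{¬l R} · ↦σᵢ  ⊆  ↦σᵢ · →_R        (i = 1, 3).
-- A σᵢ-root step fixes the shape of its source, (λt)u s or v((λt)u).  An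
-- R-step in a non-left context inside such a term cannot touch the
-- "spine" of that shape; it happens inside t, u, s or (under a λ) inside
-- the value v.  Performing the σᵢ-step first moves that subterm to a new
-- position, where the R-step is replayed; subterms that σᵢ places under
-- the new binder are weakened, so there the R-step has to be renamed.

open import Defs
open import Data.Nat using (ℕ; zero; suc)
open import Data.Product using (_×_; _,_)
open import Data.Empty using (⊥-elim)
open import Relation.Binary.PropositionalEquality
  using (_≡_; refl; sym; trans; cong; cong₂; module ≡-Reasoning)
  renaming (subst to transport)

-- Renaming and substitution respect pointwise equality of their maps
-- (needed in place of function extensionality).

ext-cong : ∀ {f g : ℕ → ℕ} → (∀ n → f n ≡ g n) → ∀ n → ext f n ≡ ext g n
ext-cong f≗g zero = refl
ext-cong f≗g (suc n) = cong suc (f≗g n)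

rename-cong : ∀ {f g : ℕ → ℕ} → (∀ n → f n ≡ g n) → ∀ t → rename f t ≡ rename g t
rename-cong f≗g (var n) = cong var (f≗g n)
rename-cong f≗g (con c) = refl
rename-cong f≗g (lam t) = cong lam (rename-cong (ext-cong f≗g) t)
rename-cong f≗g (app t u) = cong₂ app (rename-cong f≗g t) (rename-cong f≗g u)

exts-cong : ∀ {f g : ℕ → Term} → (∀ n → f n ≡ g n) → ∀ n → exts f n ≡ exts g n
exts-cong f≗g zero = refl
exts-cong f≗g (suc n) = cong shift (f≗g n)

subst-cong : ∀ {f g : ℕ → Term} → (∀ n → f n ≡ g n) → ∀ t → subst f t ≡ subst g t
subst-cong f≗g (var n) = f≗g n
subst-cong f≗g (con c) = refl
subst-cong f≗g (lam t) = cong lam (subst-cong (exts-cong f≗g) t)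
subst-cong f≗g (app t u) = cong₂ app (subst-cong f≗g t) (subst-cong f≗g u)

ext-comp : ∀ (f g : ℕ → ℕ) n → ext f (ext g n) ≡ ext (λ k → f (g k)) n
ext-comp f g zero = refl
ext-comp f g (suc n) = refl

rename-comp : ∀ f g t → rename f (rename g t) ≡ rename (λ k → f (g k)) t
rename-comp f g (var n) = refl
rename-comp f g (con c) = refl
rename-comp f g (lam t) =
  cong lam (trans (rename-comp (ext f) (ext g) t) (rename-cong (ext-comp f g) t))
rename-comp f g (app t u) = cong₂ app (rename-comp f g t) (rename-comp f g u)

rename-shift : ∀ ρ s → rename (ext ρ) (shift s) ≡ shift (rename ρ s)
rename-shift ρ s = trans (rename-comp (ext ρ) suc s) (sym (rename-comp suc ρ s))

rename-subst : ∀ ρ σ t → rename ρ (subst σ t) ≡ subst (λ n → rename ρ (σ n)) t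
rename-subst ρ σ (var n) = refl
rename-subst ρ σ (con c) = refl
rename-subst ρ σ (lam t) =
  cong lam (trans (rename-subst (ext ρ) (exts σ) t) (subst-cong rename-exts t))
  where
  rename-exts : ∀ n → rename (ext ρ) (exts σ n) ≡ exts (λ k → rename ρ (σ k)) n
  rename-exts zero = refl
  rename-exts (suc n) = rename-shift ρ (σ n)
rename-subst ρ σ (app t u) = cong₂ app (rename-subst ρ σ t) (rename-subst ρ σ u)

subst-rename : ∀ σ ρ t → subst σ (rename ρ t) ≡ subst (λ n → σ (ρ n)) t
subst-rename σ ρ (var n) = refl
subst-rename σ ρ (con c) = refl
subst-rename σ ρ (lam t) =
  cong lam (trans (subst-rename (exts σ) (ext ρ) t) (subst-cong exts-ext t))
  where
  exts-ext : ∀ n → exts σ (ext ρ n) ≡ exts (λ k → σ (ρ k)) n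
  exts-ext zero = refl
  exts-ext (suc n) = refl
subst-rename σ ρ (app t u) = cong₂ app (subst-rename σ ρ t) (subst-rename σ ρ u)

rename-single : ∀ ρ t v → rename ρ (t [ v ]) ≡ rename (ext ρ) t [ rename ρ v ]
rename-single ρ t v = begin
  rename ρ (t [ v ])                              ≡⟨ rename-subst ρ (single v) t ⟩
  subst (λ n → rename ρ (single v n)) t           ≡⟨ subst-cong single-ext t ⟩
  subst (λ n → single (rename ρ v) (ext ρ n)) t   ≡⟨ sym (subst-rename (single (rename ρ v)) (ext ρ) t) ⟩
  rename (ext ρ) t [ rename ρ v ]                 ∎
  where
  open ≡-Reasoning
  single-ext : ∀ n → rename ρ (single v n) ≡ single (rename ρ v) (ext ρ n)
  single-ext zero = refl
  single-ext (suc n) = refl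

value-rename : ∀ ρ {v} → Value v → Value (rename ρ v)
value-rename ρ (vvar n) = vvar (ρ n)
value-rename ρ (vcon c) = vcon c
value-rename ρ (vlam t) = vlam (rename (ext ρ) t)

RenamingStable : Rel → Set
RenamingStable R = ∀ ρ {r r'} → R r r' → R (rename ρ r) (rename ρ r')

βv-stable : RenamingStable _↦βv_
βv-stable ρ (βv t v v-val) =
  transport (app (lam (rename (ext ρ) t)) (rename ρ v) ↦βv_)
    (sym (rename-single ρ t v)) (βv _ _ (value-rename ρ v-val))

σ₁-stable : RenamingStable _↦σ₁_
σ₁-stable ρ (σ₁ t u s) =
  transport (λ s' → rename ρ (app (app (lam t) u) s)
                      ↦σ₁ app (lam (app (rename (ext ρ) t) s')) (rename ρ u))
    (sym (rename-shift ρ s)) (σ₁ _ _ _)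

σ₃-stable : RenamingStable _↦σ₃_
σ₃-stable ρ (σ₃ v t u v-val) =
  transport (λ v' → rename ρ (app v (app (lam t) u))
                      ↦σ₃ app (lam (app v' (rename (ext ρ) t))) (rename ρ u))
    (sym (rename-shift ρ v)) (σ₃ _ _ _ (value-rename ρ v-val))

σ-stable : RenamingStable _↦σ_
σ-stable ρ (s1 step) = s1 (σ₁-stable ρ step)
σ-stable ρ (s3 step) = s3 (σ₃-stable ρ step)

closure-appL : ∀ {R x y} t → Closure R x y → Closure R (app x t) (app y t)
closure-appL t (C , r , r' , step , refl , refl) = appL C t , r , r' , step , refl , refl

closure-appR : ∀ {R x y} t → Closure R x y → Closure R (app t x) (app t y)
closure-appR t (C , r , r' , step , refl , refl) = appR t C , r , r' , step , refl , refl

closure-lam : ∀ {R x y} → Closure R x y → Closure R (lam x) (lam y)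
closure-lam (C , r , r' , step , refl , refl) = lamC C , r , r' , step , refl , refl

closure-rename : ∀ {R} → RenamingStable R → ∀ C ρ {r r'} → R r r' →
  Closure R (rename ρ (plug C r)) (rename ρ (plug C r'))
closure-rename stable hole ρ step = hole , _ , _ , stable ρ step , refl , refl
closure-rename stable (appR t C) ρ step = closure-appR (rename ρ t) (closure-rename stable C ρ step)
closure-rename stable (appL C t) ρ step = closure-appL (rename ρ t) (closure-rename stable C ρ step)
closure-rename stable (lamC C) ρ step = closure-lam (closure-rename stable C (ext ρ) step)

-- Every left context is weak, so a step in a non-e context is a step in a
-- non-left context; it suffices to treat e = l.

left⇒strat : ∀ e {C} → IsLeft C → StratCtx e C
left⇒strat l isLeft = isLeft
left⇒strat w lhole = whole
left⇒strat w (lappL t isLeft) = wappL t (left⇒strat w isLeft)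
left⇒strat w (lappR v _ isLeft) = wappR v (left⇒strat w isLeft)

notE⇒notLeft : ∀ e {R} → NotE e R ⊆ NotE l R
notE⇒notLeft e (C , r , r' , notE , step , eq , eq') =
  C , r , r' , (λ isLeft → notE (left⇒strat e isLeft)) , step , eq , eq'

-- Commutation with σ₁ on (λt)u s: the non-left step lies inside t (under
-- the binder), u, or s; in s it moves under the new binder and is renamed.
σ₁-commute : ∀ {R} → RenamingStable R → (NotE l R · _↦σ₁_) ⊆ (_↦σ₁_ · Closure R)
σ₁-commute stable (_ , (hole , _ , _ , notLeft , _ , refl , refl) , σ₁ _ _ _) =
  ⊥-elim (notLeft lhole)
σ₁-commute stable (_ , (appL hole _ , _ , _ , notLeft , _ , refl , refl) , σ₁ _ _ _) =
  ⊥-elim (notLeft (lappL _ lhole))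
σ₁-commute stable (_ , (appL (appL hole _) _ , _ , _ , notLeft , _ , refl , refl) , σ₁ _ _ _) =
  ⊥-elim (notLeft (lappL _ (lappL _ lhole)))
σ₁-commute stable (_ , (appL (appL (lamC C) _) _ , r , r' , _ , step , refl , refl) , σ₁ _ u s) =
  _ , σ₁ _ _ _ , closure-appL u (closure-lam (closure-appL (shift s) (C , r , r' , step , refl , refl)))
σ₁-commute stable (_ , (appL (appR _ C) _ , r , r' , _ , step , refl , refl) , σ₁ _ _ _) =
  _ , σ₁ _ _ _ , closure-appR _ (C , r , r' , step , refl , refl)
σ₁-commute stable (_ , (appR _ C , _ , _ , _ , step , refl , refl) , σ₁ t u _) =
  _ , σ₁ _ _ _ , closure-appL u (closure-lam (closure-appR t (closure-rename stable C suc step)))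

-- Commutation with σ₃ on v((λt)u): the non-left step lies inside the value
-- v (necessarily under its λ, and renamed when v is weakened), inside t
-- (under the binder), or inside u.
σ₃-commute : ∀ {R} → RenamingStable R → (NotE l R · _↦σ₃_) ⊆ (_↦σ₃_ · Closure R)
σ₃-commute stable (_ , (hole , _ , _ , notLeft , _ , refl , refl) , σ₃ _ _ _ _) =
  ⊥-elim (notLeft lhole)
σ₃-commute stable (_ , (appL hole _ , _ , _ , notLeft , _ , refl , refl) , σ₃ _ _ _ _) =
  ⊥-elim (notLeft (lappL _ lhole))
σ₃-commute stable (_ , (appL (lamC C) _ , _ , _ , _ , step , refl , refl) , σ₃ _ t u _) =
  _ , σ₃ _ _ _ (vlam _) , closure-appL u (closure-lam (closure-appL t (closure-rename stable (lamC C) suc step)))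
σ₃-commute stable (_ , (appR _ hole , _ , _ , notLeft , _ , refl , refl) , σ₃ _ _ _ v-val) =
  ⊥-elim (notLeft (lappR _ v-val lhole))
σ₃-commute stable (_ , (appR _ (appL hole _) , _ , _ , notLeft , _ , refl , refl) , σ₃ _ _ _ v-val) =
  ⊥-elim (notLeft (lappR _ v-val (lappL _ lhole)))
σ₃-commute stable (_ , (appR _ (appL (lamC C) _) , r , r' , _ , step , refl , refl) , σ₃ v _ u v-val) =
  _ , σ₃ _ _ _ v-val , closure-appL u (closure-lam (closure-appR (shift v) (C , r , r' , step , refl , refl)))
σ₃-commute stable (_ , (appR _ (appR _ C) , r , r' , _ , step , refl , refl) , σ₃ _ _ _ v-val) =
  _ , σ₃ _ _ _ v-val , closure-appR _ (C , r , r' , step , refl , refl)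

σ-postpone : ∀ e i {R} → RenamingStable R → (NotE e R · RootSigma i) ⊆ (RootSigma i · Closure R)
σ-postpone e one stable (_ , step , root) = σ₁-commute stable (_ , notE⇒notLeft e step , root)
σ-postpone e three stable (_ , step , root) = σ₃-commute stable (_ , notE⇒notLeft e step , root)

lemma7p1 : (e : Strat) (i : SIdx) →
    ((NotE e _↦βv_ · RootSigma i) ⊆ (RootSigma i · _→βv_))
    × ((NotE e _↦σ_ · RootSigma i) ⊆ (RootSigma i · _→σ_))
lemma7p1 e i = σ-postpone e i βv-stable , σ-postpone e i σ-stable
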